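{- Let $G$ be an undirected graph, regarded as a digraph with symmetric edge relation. (i) If every connected component of $G$ is either trivial or a complete graph with loops, then $\mathbb{A}(G)$ satisfies every bracketing identity. (ii) If every connected component of $G$ is either trivial, a complete graph with loops, or a complete bipartite graph, and the last case occurs at least once, then for all $n$ and all $t,t'\in B_n$ with $t\ne t'$, $\mathbb{A}(G)$ satisfies $t\approx t'$ if and only if $M_{t,t'}$ is even. (iii) Otherwise $\mathbb{A}(G)$ satisfies no bracketing identity $t\approx t'$ with $t\ne t'$.
   Context: The graph algebra $\mathbb{A}(G)$ of a digraph $G=(V,E)$ is the groupoid on $V\cup\{\infty\}$ ($\infty\notin V$) with $uv=u$ if $u,v\in V$ and $(u,v)\in E$, and $uv=\infty$ otherwise. $B_n$ is the set of bracketings of $x_1x_2\cdots x_n$ (binary terms with $x_1,\dots,x_n$ each occurring once, in this order); a bracketing identity is $t\approx t'$ with $t,t'\in B_n$. A trivial connected component is a single vertex without a loop; a complete graph with loops has all pairs of (not necessarily distinct) vertices adjacent; complete bipartite graphs are $K_{p,q}$ with $p,q\ge1$, without loops. For $t\in B_n$, $G(t)$ is the rooted tree on $\{x_1,\dots,x_n\}$ defined recursively: $G(x_i)$ is the single vertex $x_i$; for $t=t_1t_2$, $G(t)$ is $G(t_1)\cup G(t_2)$ plus an edge from the root of $G(t_1)$ to the root of $G(t_2)$, rooted at the root of $G(t_1)$. With $T=G(t)$, $T'=G(t')$ and $d_T(x)$ the depth of $x$ in $T$, $M_{t,t'}=\gcd\{|d_T(x)-d_{T'}(x)|:x\in\{x_1,\dots,x_n\}\}$.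 -}

module Defs where

open import Level using (Level)
open import Data.Bool using (Bool; true; false; if_then_else_; _xor_)
open import Data.Maybe using (Maybe; just; nothing)
open import Data.Nat using (ℕ; zero; suc; _+_; ∣_-_∣)
open import Data.Nat.GCD using (gcd)
open import Data.Nat.Divisibility using (_∣_)
open import Data.Fin using (Fin; zero; _↑ˡ_; _↑ʳ_; splitAt)
open import Data.List using (List; foldr; map; allFin)
open import Data.Sum using (_⊎_; inj₁; inj₂; [_,_])
open import Data.Product using (Σ; _×_; _,_; ∃)
open import Relation.Binary.PropositionalEquality using (_≡_)
open import Relation.Binary.Construct.Closure.ReflexiveTransitive using (Star)
open import Function using (_∘_)

Edge : ∀ {ℓ} {V : Set ℓ} → (V → V → Bool) → V → V → Set
Edge adj u v = adj u v ≡ true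

Symmetric : ∀ {ℓ} {V : Set ℓ} → (V → V → Bool) → Set ℓ
Symmetric {V = V} adj = ∀ (u v : V) → adj u v ≡ adj v u

-- Graph algebra A(G): carrier V ∪ {∞}, with ∞ represented by nothing.

GA : ∀ {ℓ} → Set ℓ → Set ℓ
GA V = Maybe V

gop : ∀ {ℓ} {V : Set ℓ} → (V → V → Bool) → GA V → GA V → GA V
gop adj (just u) (just v) = if adj u v then just u else nothing
gop adj (just u) nothing  = nothing
gop adj nothing  _        = nothing

-- Bracketings: B n = binary terms in x₁ … xₙ, each once, in order.
-- Variables of a bracketing with n leaves are Fin n (x₁ ↦ zero, …).

data B : ℕ → Set where
  x    : B 1
  _·_  : ∀ {m k} → B m → B k → B (m + k)

eval : ∀ {ℓ} {V : Set ℓ} → (V → V → Bool) → ∀ {n} → B n → (Fin n → GA V) → GA V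
eval adj x f = f zero
eval adj (_·_ {m} {k} t₁ t₂) f =
  gop adj (eval adj t₁ (f ∘ (_↑ˡ k))) (eval adj t₂ (f ∘ (m ↑ʳ_)))

Satisfies : ∀ {ℓ} {V : Set ℓ} → (V → V → Bool) → ∀ {n} → B n → B n → Set ℓ
Satisfies {V = V} adj {n} t t' = ∀ (f : Fin n → GA V) → eval adj t f ≡ eval adj t' f

-- Depth of the variable xᵢ in the rooted tree G(t).
-- G(x) has depth 0 at its root; for t = t₁t₂ the root is that of G(t₁),
-- vertices of G(t₁) keep their depth, and G(t₂) hangs below the root of
-- G(t₁) via one edge, so vertices of G(t₂) get depth one more.

depth : ∀ {n} → B n → Fin n → ℕ
depth x i = 0
depth (_·_ {m} t₁ t₂) i = [ depth t₁ , (λ j → suc (depth t₂ j)) ] (splitAt m i)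

-- M_{t,t'} = gcd { |d_T(x) - d_T'(x)| : x }   (gcd of all zeros is 0)
M : ∀ {n} → B n → B n → ℕ
M {n} t t' = foldr gcd 0 (map (λ i → ∣ depth t i - depth t' i ∣) (allFin n))

Even : ℕ → Set
Even k = 2 ∣ k

Conn : ∀ {ℓ} {V : Set ℓ} → (V → V → Bool) → V → V → Set ℓ
Conn adj = Star (Edge adj)

TrivialComp : ∀ {ℓ} {V : Set ℓ} → (V → V → Bool) → V → Set ℓ
TrivialComp {V = V} adj u = (∀ (v : V) → Conn adj u v → v ≡ u) × (adj u u ≡ false)

CompleteLoopsComp : ∀ {ℓ} {V : Set ℓ} → (V → V → Bool) → V → Set ℓ
CompleteLoopsComp {V = V} adj u =
  ∀ (v w : V) → Conn adj u v → Conn adj u w → adj v w ≡ true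

CompleteBipartiteComp : ∀ {ℓ} {V : Set ℓ} → (V → V → Bool) → V → Set ℓ
CompleteBipartiteComp {V = V} adj u =
  Σ (V → Bool) λ c →
    (∀ (v w : V) → Conn adj u v → Conn adj u w → adj v w ≡ (c v xor c w))
    × (Σ V λ v → Conn adj u v × c v ≡ true)
    × (Σ V λ v → Conn adj u v × c v ≡ false)

-- An assignment f makes a bracketing t defined in A(G) exactly when f takes values in V and is a
-- graph homomorphism from the tree G(t) to G; the value is then f x₁, whatever t is. So A(G)
-- satisfies t ≈ t' iff G(t) and G(t') have the same homomorphisms into G. Such a homomorphism maps
-- the tree into the component of the image of its root. Into a trivial component only the
-- one-vertex tree maps, into a complete graph with loops everything maps, and into K_{p,q} exactly
-- the maps whose colours alternate with the depth; the latter is what M_{t,t'} measures. Any other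
-- connected component contains a walk w whose vertices w a and w b are not adjacent, for every
-- |a - b| ≥ 2 (it suffices to get |a - b| = 2 and 3 and then pad walks by going back and forth).
-- For t ≠ t' one of the trees has an edge whose endpoints lie at depths at least 2 apart in the
-- other tree; composing the depth function of the other tree with such a walk gives a homomorphism
-- of one tree that is not a homomorphism of the other.
module Submission where

open import Defs
open import Data.Bool using (Bool; true; false; not; _xor_; if_then_else_)
open import Data.Bool.Properties
  using (not-involutive; not-distribˡ-xor; not-distribʳ-xor; xor-identityʳ; xor-inverseʳ; ¬-not; not-¬)
open import Data.Empty using (⊥-elim)
open import Data.Fin using (Fin; zero; suc; toℕ; _↑ˡ_; _↑ʳ_)
open import Data.Fin.Properties using (toℕ-↑ˡ; toℕ-↑ʳ; toℕ<n; toℕ-injective; splitAt-↑ˡ; splitAt-↑ʳ)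
open import Data.List using (List; []; _∷_; foldr)
open import Data.List.Relation.Unary.All using (All; []; _∷_)
open import Data.List.Relation.Unary.All.Properties using (map⁺; map⁻; tabulate⁺; tabulate⁻)
open import Data.Maybe using (Maybe; just; nothing)
open import Data.Maybe.Properties using (just-injective)
open import Data.Nat using (ℕ; zero; suc; _+_; _≤_; _<_; z≤n; s≤s; ∣_-_∣)
open import Data.Nat.Divisibility using (_∣_; divides; ∣-trans; _∣0)
open import Data.Nat.GCD using (gcd; gcd[m,n]∣m; gcd[m,n]∣n; gcd-greatest)
open import Data.Nat.Properties
  using (≤-trans; m≤m+n; +-mono-≤; 1+n≰n; <⇒≱; <⇒≤; <-cmp; +-cancelˡ-≡; +-cancelˡ-<; +-identityʳ)
open import Data.Product using (Σ; _×_; _,_; proj₁; proj₂)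
open import Data.Sum using (_⊎_; inj₁; inj₂; [_,_]) renaming (map to ⊎-map)
open import Data.Unit using (⊤; tt)
open import Function using (_∘_)
open import Function.Bundles using (_⇔_; mk⇔; Equivalence)
open import Relation.Binary.Construct.Closure.ReflexiveTransitive using (ε; _◅_)
open import Relation.Binary.Definitions using (tri<; tri≈; tri>)
open import Relation.Binary.PropositionalEquality
  using (_≡_; _≢_; refl; sym; trans; cong; cong₂; subst; subst₂; module ≡-Reasoning)
open import Relation.Nullary using (¬_)
open import Relation.Nullary.Negation using (¬¬-map)

-- Bracketings and their trees

B-nonempty : ∀ {n} → B n → 1 ≤ n
B-nonempty x = s≤s z≤n
B-nonempty (_·_ {m} {k} t₁ t₂) = ≤-trans (B-nonempty t₁) (m≤m+n m k)

B1-unique : (t : B 1) → t ≡ x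
B1-unique t = go t refl
  where
  go : ∀ {n} (t : B n) (e : n ≡ 1) → subst B e t ≡ x
  go x refl = refl
  go (t₁ · t₂) e = ⊥-elim (1+n≰n (subst (2 ≤_) e (+-mono-≤ (B-nonempty t₁) (B-nonempty t₂))))

root : ∀ {n} → B n → Fin n
root x = zero
root (_·_ {k = k} t₁ t₂) = root t₁ ↑ˡ k

toℕ-root : ∀ {n} (t : B n) → toℕ (root t) ≡ 0
toℕ-root x = refl
toℕ-root (_·_ {k = k} t₁ t₂) = trans (toℕ-↑ˡ (root t₁) k) (toℕ-root t₁)

root-unique : ∀ {n} (t t' : B n) → root t ≡ root t'
root-unique t t' = toℕ-injective (trans (toℕ-root t) (sym (toℕ-root t')))

data Split (m k : ℕ) : Fin (m + k) → Set where
  inˡ : (j : Fin m) → Split m k (j ↑ˡ k)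
  inʳ : (j : Fin k) → Split m k (m ↑ʳ j)

split : ∀ m k (i : Fin (m + k)) → Split m k i
split zero k i = inʳ i
split (suc m) k zero = inˡ zero
split (suc m) k (suc i) with split m k i
... | inˡ j = inˡ (suc j)
... | inʳ j = inʳ j

module _ {m k : ℕ} (t₁ : B m) (t₂ : B k) where

  depth-↑ˡ : ∀ j → depth (t₁ · t₂) (j ↑ˡ k) ≡ depth t₁ j
  depth-↑ˡ j rewrite splitAt-↑ˡ m j k = refl

  depth-↑ʳ : ∀ j → depth (t₁ · t₂) (m ↑ʳ j) ≡ suc (depth t₂ j)
  depth-↑ʳ j rewrite splitAt-↑ʳ m k j = refl

depth-root : ∀ {n} (t : B n) → depth t (root t) ≡ 0
depth-root x = refl
depth-root (t₁ · t₂) = trans (depth-↑ˡ t₁ t₂ (root t₁)) (depth-root t₁)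

depth-root-child : ∀ {m k} (t₁ : B m) (t₂ : B k) → depth (t₁ · t₂) (m ↑ʳ root t₂) ≡ 1
depth-root-child t₁ t₂ = trans (depth-↑ʳ t₁ t₂ (root t₂)) (cong suc (depth-root t₂))

depth-nonroot : ∀ {n} (t : B n) (i : Fin n) → 1 ≤ toℕ i → 1 ≤ depth t i
depth-nonroot x zero ()
depth-nonroot (_·_ {m} {k} t₁ t₂) i 1≤i with split m k i
... | inˡ j rewrite depth-↑ˡ t₁ t₂ j = depth-nonroot t₁ j (subst (1 ≤_) (toℕ-↑ˡ j k) 1≤i)
... | inʳ j rewrite depth-↑ʳ t₁ t₂ j = s≤s z≤n

-- For t = t₁ t₂ with t₁ ∈ B m this is m, the index of the root of t₂.
lastSplit : ∀ {n} → B n → ℕ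
lastSplit x = 0
lastSplit (_·_ {m} t₁ t₂) = m

toℕ-lastChild : ∀ {m k} (t₂ : B k) → toℕ (m ↑ʳ root t₂) ≡ m
toℕ-lastChild {m} t₂ = trans (toℕ-↑ʳ m (root t₂)) (trans (cong (m +_) (toℕ-root t₂)) (+-identityʳ m))

beyond-lastSplit : ∀ {n} (t : B n) (q : Fin n) → lastSplit t < toℕ q → 2 ≤ depth t q
beyond-lastSplit x zero ()
beyond-lastSplit (_·_ {m} {k} t₁ t₂) q m<q with split m k q
... | inˡ j = ⊥-elim (<⇒≱ (subst (_< m) (sym (toℕ-↑ˡ j k)) (toℕ<n j)) (<⇒≤ m<q))
... | inʳ j rewrite depth-↑ʳ t₁ t₂ j =
  s≤s (depth-nonroot t₂ j (+-cancelˡ-< m 0 (toℕ j)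
    (subst₂ _<_ (sym (+-identityʳ m)) (toℕ-↑ʳ m j) m<q)))

split-at-lastSplit : ∀ {m k} (t : B (m + k)) → lastSplit t ≡ m → 1 ≤ m →
  Σ (B m) λ s₁ → Σ (B k) λ s₂ → t ≡ s₁ · s₂
split-at-lastSplit t = go t refl
  where
  go : ∀ {n m k} (t : B n) (e : n ≡ m + k) → lastSplit t ≡ m → 1 ≤ m →
    Σ (B m) λ s₁ → Σ (B k) λ s₂ → subst B e t ≡ s₁ · s₂
  go x e refl ()
  go {k = k} (_·_ {m} {k'} s₁ s₂) e refl _ with +-cancelˡ-≡ m k' k e
  ... | refl with e
  ...   | refl = s₁ , s₂ , refl

data TreeEdge : ∀ {n} → B n → Fin n → Fin n → Set where
  rootEdge  : ∀ {m k} (t₁ : B m) (t₂ : B k) → TreeEdge (t₁ · t₂) (root t₁ ↑ˡ k) (m ↑ʳ root t₂)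
  leftEdge  : ∀ {m k} {t₁ : B m} (t₂ : B k) {i j} → TreeEdge t₁ i j → TreeEdge (t₁ · t₂) (i ↑ˡ k) (j ↑ˡ k)
  rightEdge : ∀ {m k} (t₁ : B m) {t₂ : B k} {i j} → TreeEdge t₂ i j → TreeEdge (t₁ · t₂) (m ↑ʳ i) (m ↑ʳ j)

lastEdge : ∀ {n} (t : B n) → 0 < lastSplit t →
  Σ (Fin n) λ p → toℕ p ≡ lastSplit t × TreeEdge t (root t) p
lastEdge (t₁ · t₂) _ = _ , toℕ-lastChild t₂ , rootEdge t₁ t₂

-- Distinct bracketings have a far edge

FarApart : ℕ → ℕ → Set
FarApart a b = 2 + a ≤ b ⊎ 2 + b ≤ a

FarEdge : ∀ {n} → B n → B n → Set
FarEdge {n} t t' = Σ (Fin n) λ i → Σ (Fin n) λ j → TreeEdge t i j × FarApart (depth t' i) (depth t' j)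

farApart-from-root : ∀ {n} (t : B n) {i j} → i ≡ root t → 2 ≤ depth t j → FarApart (depth t i) (depth t j)
farApart-from-root t refl 2≤j rewrite depth-root t = inj₁ 2≤j

module _ {m k : ℕ} (t₁ s₁ : B m) (t₂ s₂ : B k) where

  farEdge-·ˡ : FarEdge t₁ s₁ → FarEdge (t₁ · t₂) (s₁ · s₂)
  farEdge-·ˡ (i , j , e , far) =
    i ↑ˡ k , j ↑ˡ k , leftEdge t₂ e ,
    subst₂ FarApart (sym (depth-↑ˡ s₁ s₂ i)) (sym (depth-↑ˡ s₁ s₂ j)) far

  farEdge-·ʳ : FarEdge t₂ s₂ → FarEdge (t₁ · t₂) (s₁ · s₂)
  farEdge-·ʳ (i , j , e , far) =
    m ↑ʳ i , m ↑ʳ j , rightEdge t₁ e ,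
    subst₂ FarApart (sym (depth-↑ʳ s₁ s₂ i)) (sym (depth-↑ʳ s₁ s₂ j)) (farApart-suc far)
    where
    farApart-suc : ∀ {a b} → FarApart a b → FarApart (suc a) (suc b)
    farApart-suc (inj₁ h) = inj₁ (s≤s h)
    farApart-suc (inj₂ h) = inj₂ (s≤s h)

-- Compare where the last subtree of t' starts with where t₂ starts in t = t₁ t₂.
≢⇒¬¬farEdge : ∀ {n} (t t' : B n) → t ≢ t' → ¬ ¬ (FarEdge t t' ⊎ FarEdge t' t)
≢⇒¬¬farEdge x t' x≢t' _ = x≢t' (sym (B1-unique t'))
≢⇒¬¬farEdge (_·_ {m} {k} t₁ t₂) t' t≢t' noFar with <-cmp (lastSplit t') m
... | tri< p<m _ _ =
  noFar (inj₁ (_ , _ , rootEdge t₁ t₂ , farApart-from-root t' (root-unique (t₁ · t₂) t')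
    (beyond-lastSplit t' _ (subst (lastSplit t' <_) (sym (toℕ-lastChild t₂)) p<m))))
... | tri> _ _ m<p with lastEdge t' (≤-trans (B-nonempty t₁) (<⇒≤ m<p))
...   | p , p≡lastSplit , edge =
  noFar (inj₂ (_ , _ , edge , farApart-from-root (t₁ · t₂) (root-unique t' (t₁ · t₂))
    (beyond-lastSplit (t₁ · t₂) p (subst (m <_) (sym p≡lastSplit) m<p))))
≢⇒¬¬farEdge (_·_ {m} {k} t₁ t₂) t' t≢t' noFar | tri≈ _ p≡m _
  with split-at-lastSplit t' p≡m (B-nonempty t₁)
... | s₁ , s₂ , refl =
  ≢⇒¬¬farEdge t₁ s₁
    (λ t₁≡s₁ → ≢⇒¬¬farEdge t₂ s₂ (λ t₂≡s₂ → t≢t' (cong₂ _·_ t₁≡s₁ t₂≡s₂))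
      (noFar ∘ ⊎-map (farEdge-·ʳ t₁ s₁ t₂ s₂) (farEdge-·ʳ s₁ t₁ s₂ t₂)))
    (noFar ∘ ⊎-map (farEdge-·ˡ t₁ s₁ t₂ s₂) (farEdge-·ˡ s₁ t₁ s₂ t₂))

-- Parity of depths and M

odd : ℕ → Bool
odd zero = false
odd (suc n) = not (odd n)

SameParity : ∀ {n} → B n → B n → Set
SameParity {n} t t' = ∀ (i : Fin n) → odd (depth t i) ≡ odd (depth t' i)

not-xor-swap : ∀ p q → not p xor q ≡ p xor not q
not-xor-swap p q = trans (sym (not-distribˡ-xor p q)) (not-distribʳ-xor p q)

odd-∣-∣ : ∀ a b → odd ∣ a - b ∣ ≡ odd a xor odd b
odd-∣-∣ zero b = refl
odd-∣-∣ (suc a) zero = sym (xor-identityʳ (odd (suc a)))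
odd-∣-∣ (suc a) (suc b) = begin
  odd ∣ a - b ∣                 ≡⟨ odd-∣-∣ a b ⟩
  odd a xor odd b               ≡⟨ cong (_xor odd b) (sym (not-involutive (odd a))) ⟩
  not (not (odd a)) xor odd b   ≡⟨ not-xor-swap (not (odd a)) (odd b) ⟩
  not (odd a) xor not (odd b)   ∎
  where open ≡-Reasoning

2∣⇔odd≡false : ∀ n → 2 ∣ n ⇔ odd n ≡ false
2∣⇔odd≡false n = mk⇔ to (from n)
  where
  to : ∀ {n} → 2 ∣ n → odd n ≡ false
  to (divides zero refl) = refl
  to (divides (suc q) refl) = trans (not-involutive _) (to (divides q refl))
  from : ∀ n → odd n ≡ false → 2 ∣ n
  from zero _ = 2 ∣0
  from (suc zero) ()
  from (suc (suc n)) odd≡false with from n (trans (sym (not-involutive (odd n))) odd≡false)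
  ... | divides q refl = divides (suc q) refl

xor≡false⇔≡ : ∀ p q → p xor q ≡ false ⇔ p ≡ q
xor≡false⇔≡ false q = mk⇔ sym sym
xor≡false⇔≡ true false = mk⇔ (λ ()) (λ ())
xor≡false⇔≡ true true = mk⇔ (λ _ → refl) (λ _ → refl)

∣foldr-gcd⇔All : ∀ {d} (xs : List ℕ) → d ∣ foldr gcd 0 xs ⇔ All (d ∣_) xs
∣foldr-gcd⇔All xs = mk⇔ (to xs) from
  where
  to : ∀ {d} xs → d ∣ foldr gcd 0 xs → All (d ∣_) xs
  to [] _ = []
  to (y ∷ xs) d∣ = ∣-trans d∣ (gcd[m,n]∣m y _) ∷ to xs (∣-trans d∣ (gcd[m,n]∣n y _))
  from : ∀ {d xs} → All (d ∣_) xs → d ∣ foldr gcd 0 xs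
  from [] = _ ∣0
  from (d∣y ∷ d∣xs) = gcd-greatest d∣y (from d∣xs)

even-M⇔sameParity : ∀ {n} (t t' : B n) → Even (M t t') ⇔ SameParity t t'
even-M⇔sameParity t t' = mk⇔
  (λ even i → Equivalence.to (diff i) (tabulate⁻ (map⁻ (Equivalence.to (∣foldr-gcd⇔All _) even)) i))
  (λ same → Equivalence.from (∣foldr-gcd⇔All _) (map⁺ (tabulate⁺ λ i → Equivalence.from (diff i) (same i))))
  where
  diff : ∀ i → 2 ∣ ∣ depth t i - depth t' i ∣ ⇔ odd (depth t i) ≡ odd (depth t' i)
  diff i = mk⇔
    (λ 2∣ → Equivalence.to (xor≡false⇔≡ _ _)
      (trans (sym (odd-∣-∣ (depth t i) (depth t' i))) (Equivalence.to (2∣⇔odd≡false _) 2∣)))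
    (λ same → Equivalence.from (2∣⇔odd≡false _)
      (trans (odd-∣-∣ (depth t i) (depth t' i)) (Equivalence.from (xor≡false⇔≡ _ _) same)))

-- Evaluation in A(G) and homomorphisms of trees

module _ {ℓ} {V : Set ℓ} (adj : V → V → Bool) where

  Hom : ∀ {n} → B n → (Fin n → V) → Set
  Hom x g = ⊤
  Hom (_·_ {m} {k} t₁ t₂) g =
    Hom t₁ (g ∘ (_↑ˡ k)) × Hom t₂ (g ∘ (m ↑ʳ_)) × Edge adj (g (root t₁ ↑ˡ k)) (g (m ↑ʳ root t₂))

  Homs⊆ : ∀ {n} → B n → B n → Set ℓ
  Homs⊆ {n} t t' = ∀ (g : Fin n → V) → Hom t g → Hom t' g

  Walk : (ℕ → V) → Set
  Walk w = ∀ i → Edge adj (w i) (w (suc i))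

  hom-cong : ∀ {n} (t : B n) {g h} → (∀ i → g i ≡ h i) → Hom t g → Hom t h
  hom-cong x g≗h _ = tt
  hom-cong (_·_ {m} {k} t₁ t₂) g≗h (hom₁ , hom₂ , e) =
    hom-cong t₁ (g≗h ∘ (_↑ˡ k)) hom₁ , hom-cong t₂ (g≗h ∘ (m ↑ʳ_)) hom₂ ,
    subst₂ (Edge adj) (g≗h _) (g≗h _) e

  hom-edge : ∀ {n} {t : B n} {i j} g → TreeEdge t i j → Hom t g → Edge adj (g i) (g j)
  hom-edge g (rootEdge t₁ t₂) (_ , _ , e) = e
  hom-edge g (leftEdge t₂ edge) (hom₁ , _ , _) = hom-edge _ edge hom₁
  hom-edge g (rightEdge t₁ edge) (_ , hom₂ , _) = hom-edge _ edge hom₂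

  hom-reaches : ∀ {n} (t : B n) g → Hom t g → ∀ i → Conn adj (g (root t)) (g i)
  hom-reaches x g _ zero = ε
  hom-reaches (_·_ {m} {k} t₁ t₂) g (hom₁ , hom₂ , e) i with split m k i
  ... | inˡ j = hom-reaches t₁ _ hom₁ j
  ... | inʳ j = e ◅ hom-reaches t₂ _ hom₂ j

  complete⇒hom : ∀ {n} (t : B n) g → (∀ i j → Edge adj (g i) (g j)) → Hom t g
  complete⇒hom x g _ = tt
  complete⇒hom (t₁ · t₂) g complete =
    complete⇒hom t₁ _ (λ i j → complete _ _) , complete⇒hom t₂ _ (λ i j → complete _ _) , complete _ _

  walk⇒hom : ∀ {n} (t : B n) w → Walk w → Hom t (w ∘ depth t)
  walk⇒hom x w _ = tt
  walk⇒hom (t₁ · t₂) w walk =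
    hom-cong t₁ (cong w ∘ sym ∘ depth-↑ˡ t₁ t₂) (walk⇒hom t₁ w walk) ,
    hom-cong t₂ (cong w ∘ sym ∘ depth-↑ʳ t₁ t₂) (walk⇒hom t₂ (w ∘ suc) (walk ∘ suc)) ,
    subst₂ (λ a b → Edge adj (w a) (w b))
      (sym (depth-root (t₁ · t₂))) (sym (depth-root-child t₁ t₂)) (walk 0)

  gop-just : ∀ p q {a} → gop adj p q ≡ just a → Σ V λ b → p ≡ just a × q ≡ just b × Edge adj a b
  gop-just (just u) (just v) e with adj u v in uv
  gop-just (just u) (just v) refl | true = v , refl , refl , uv
  gop-just (just u) (just v) () | false
  gop-just (just u) nothing ()
  gop-just nothing q ()

  eval-cong : ∀ {n} (t : B n) {f h} → (∀ i → f i ≡ h i) → eval adj t f ≡ eval adj t h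
  eval-cong x f≗h = f≗h zero
  eval-cong (_·_ {m} {k} t₁ t₂) f≗h =
    cong₂ (gop adj) (eval-cong t₁ (f≗h ∘ (_↑ˡ k))) (eval-cong t₂ (f≗h ∘ (m ↑ʳ_)))

  hom⇒eval : ∀ {n} (t : B n) g → Hom t g → eval adj t (just ∘ g) ≡ just (g (root t))
  hom⇒eval x g _ = refl
  hom⇒eval (t₁ · t₂) g (hom₁ , hom₂ , e)
    rewrite hom⇒eval t₁ _ hom₁ | hom⇒eval t₂ _ hom₂ | e = refl

  eval⇒hom : ∀ {n} (t : B n) g {a} → eval adj t (just ∘ g) ≡ just a → Hom t g
  eval⇒hom x g _ = tt
  eval⇒hom (_·_ {m} {k} t₁ t₂) g e with gop-just (eval adj t₁ _) (eval adj t₂ _) e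
  ... | _ , e₁ , e₂ , edge =
    hom₁ , hom₂ , subst₂ (Edge adj) (just-injective (trans (sym e₁) (hom⇒eval t₁ _ hom₁)))
                                    (just-injective (trans (sym e₂) (hom⇒eval t₂ _ hom₂))) edge
    where
    hom₁ : Hom t₁ (g ∘ (_↑ˡ k))
    hom₁ = eval⇒hom t₁ _ e₁
    hom₂ : Hom t₂ (g ∘ (m ↑ʳ_))
    hom₂ = eval⇒hom t₂ _ e₂

  eval-just⇒just : ∀ {n} (t : B n) f {a} → eval adj t f ≡ just a → ∀ i → Σ V λ b → f i ≡ just b
  eval-just⇒just x f e zero = _ , e
  eval-just⇒just (_·_ {m} {k} t₁ t₂) f e i with gop-just (eval adj t₁ _) (eval adj t₂ _) e | split m k i
  ... | _ , e₁ , _ , _ | inˡ j = eval-just⇒just t₁ _ e₁ j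
  ... | _ , _ , e₂ , _ | inʳ j = eval-just⇒just t₂ _ e₂ j

  -- Both sides evaluate to the value of x₁, the common root of G(t) and G(t').
  homs⊆⇒eval-just : ∀ {n} (t t' : B n) → Homs⊆ t t' → ∀ {f a} → eval adj t f ≡ just a → eval adj t' f ≡ just a
  homs⊆⇒eval-just t t' t⊆t' {f} {a} e = begin
    eval adj t' f           ≡⟨ eval-cong t' f≗ ⟩
    eval adj t' (just ∘ g)  ≡⟨ hom⇒eval t' g (t⊆t' g hom) ⟩
    just (g (root t'))      ≡⟨ cong (just ∘ g) (root-unique t' t) ⟩
    just (g (root t))       ≡⟨ sym (hom⇒eval t g hom) ⟩
    eval adj t (just ∘ g)   ≡⟨ sym (eval-cong t f≗) ⟩
    eval adj t f            ≡⟨ e ⟩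
    just a                  ∎
    where
    open ≡-Reasoning
    g : _ → V
    g i = proj₁ (eval-just⇒just t f e i)
    f≗ : ∀ i → f i ≡ just (g i)
    f≗ i = proj₂ (eval-just⇒just t f e i)
    hom : Hom t g
    hom = eval⇒hom t g (trans (sym (eval-cong t f≗)) e)

  homs⊆⇒satisfies : ∀ {n} (t t' : B n) → Homs⊆ t t' → Homs⊆ t' t → Satisfies adj t t'
  homs⊆⇒satisfies t t' t⊆t' t'⊆t f = ≡-by-just (homs⊆⇒eval-just t t' t⊆t') (homs⊆⇒eval-just t' t t'⊆t)
    where
    ≡-by-just : {p q : Maybe V} → (∀ {a} → p ≡ just a → q ≡ just a) → (∀ {a} → q ≡ just a → p ≡ just a) → p ≡ q
    ≡-by-just {just a} p⇒q _ = sym (p⇒q refl)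
    ≡-by-just {nothing} {just b} _ q⇒p = q⇒p refl
    ≡-by-just {nothing} {nothing} _ _ = refl

  satisfies⇒homs⊆ : ∀ {n} (t t' : B n) → Satisfies adj t t' → Homs⊆ t t'
  satisfies⇒homs⊆ t t' sat g hom = eval⇒hom t' g (trans (sym (sat _)) (hom⇒eval t g hom))

  -- Homomorphisms into the three kinds of components

  module _ (c : V → Bool) where

    ColouredBy : ∀ {n} → (Fin n → V) → Set
    ColouredBy g = ∀ i j → adj (g i) (g j) ≡ c (g i) xor c (g j)

    hom⇒colour≡parity : ∀ {n} (t : B n) g → Hom t g → ColouredBy g →
      ∀ i → c (g i) ≡ odd (depth t i) xor c (g (root t))
    hom⇒colour≡parity x g _ _ zero = refl
    hom⇒colour≡parity (_·_ {m} {k} t₁ t₂) g (hom₁ , hom₂ , e) coloured i with split m k i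
    ... | inˡ j rewrite depth-↑ˡ t₁ t₂ j = hom⇒colour≡parity t₁ _ hom₁ (λ _ _ → coloured _ _) j
    ... | inʳ j rewrite depth-↑ʳ t₁ t₂ j = begin
      c (g (m ↑ʳ j))                                   ≡⟨ hom⇒colour≡parity t₂ _ hom₂ (λ _ _ → coloured _ _) j ⟩
      odd (depth t₂ j) xor c (g (m ↑ʳ root t₂))        ≡⟨ cong (odd (depth t₂ j) xor_) c₂≡not-c₁ ⟩
      odd (depth t₂ j) xor not (c (g (root t₁ ↑ˡ k)))  ≡⟨ not-xor-swap (odd (depth t₂ j)) _ ⟨
      not (odd (depth t₂ j)) xor c (g (root t₁ ↑ˡ k))  ∎
      where
      open ≡-Reasoning
      xor≡true⇒≡not : ∀ {p q} → p xor q ≡ true → q ≡ not p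
      xor≡true⇒≡not {false} refl = refl
      xor≡true⇒≡not {true} {false} refl = refl
      c₂≡not-c₁ : c (g (m ↑ʳ root t₂)) ≡ not (c (g (root t₁ ↑ˡ k)))
      c₂≡not-c₁ = xor≡true⇒≡not (trans (sym (coloured _ _)) e)

    colour≡parity⇒hom : ∀ {n} (t : B n) g K → ColouredBy g →
      (∀ i → c (g i) ≡ odd (depth t i) xor K) → Hom t g
    colour≡parity⇒hom x g K _ _ = tt
    colour≡parity⇒hom (t₁ · t₂) g K coloured parity =
      colour≡parity⇒hom t₁ _ K (λ _ _ → coloured _ _)
        (λ j → trans (parity _) (cong (λ d → odd d xor K) (depth-↑ˡ t₁ t₂ j))) ,
      colour≡parity⇒hom t₂ _ (not K) (λ _ _ → coloured _ _)
        (λ j → trans (parity _) (trans (cong (λ d → odd d xor K) (depth-↑ʳ t₁ t₂ j))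
                                        (not-xor-swap (odd (depth t₂ j)) K))) ,
      trans (coloured _ _)
        (trans (cong₂ _xor_
          (trans (parity _) (cong (λ d → odd d xor K) (depth-root (t₁ · t₂))))
          (trans (parity _) (cong (λ d → odd d xor K) (depth-root-child t₁ t₂))))
          (xor-inverseʳ K))

  trivial-homs⊆ : ∀ {n} (t t' : B n) g → TrivialComp adj (g (root t)) → Hom t g → Hom t' g
  trivial-homs⊆ x t' g _ _ rewrite B1-unique t' = tt
  trivial-homs⊆ (t₁ · t₂) t' g (isolated , loopless) (_ , _ , e) =
    ⊥-elim (not-¬ (subst (Edge adj _) (isolated _ (e ◅ ε)) e) loopless)

  complete-homs⊆ : ∀ {n} (t t' : B n) g → CompleteLoopsComp adj (g (root t)) → Hom t g → Hom t' g
  complete-homs⊆ t t' g complete hom =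
    complete⇒hom t' g λ i j → complete (g i) (g j) (hom-reaches t g hom i) (hom-reaches t g hom j)

  bipartite-homs⊆ : ∀ {n} (t t' : B n) g → CompleteBipartiteComp adj (g (root t)) → SameParity t t' →
    Hom t g → Hom t' g
  bipartite-homs⊆ t t' g (c , rule , _) same hom =
    colour≡parity⇒hom c t' g (c (g (root t))) coloured
      (λ i → trans (hom⇒colour≡parity c t g hom coloured i) (cong (_xor c (g (root t))) (same i)))
    where
    coloured : ColouredBy c g
    coloured i j = rule _ _ (hom-reaches t g hom i) (hom-reaches t g hom j)

  zigzag : V → V → ℕ → V
  zigzag a b n = if odd n then b else a

  zigzag-walk : ∀ {a b} → Edge adj a b → Edge adj b a → Walk (zigzag a b)
  zigzag-walk ab ba n with odd n
  ... | true = ba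
  ... | false = ab

  -- The zigzag between the colour classes, read along depths in G(t), is a homomorphism of G(t);
  -- as a homomorphism of G(t') its colours are the depth parities in G(t').
  satisfies⇒sameParity : ∀ {u} → CompleteBipartiteComp adj u →
    ∀ {n} (t t' : B n) → Satisfies adj t t' → SameParity t t'
  satisfies⇒sameParity {u} (c , rule , (v₁ , u~v₁ , c₁) , (v₀ , u~v₀ , c₀)) t t' sat i = begin
    odd (depth t i)                                ≡⟨ sym (colour-zigzag (depth t i)) ⟩
    c (g i)                                        ≡⟨ hom⇒colour≡parity c t' g hom' coloured i ⟩
    odd (depth t' i) xor c (g (root t'))           ≡⟨ cong (λ d → odd (depth t' i) xor c (w d)) depth-root' ⟩
    odd (depth t' i) xor c v₀                      ≡⟨ cong (odd (depth t' i) xor_) c₀ ⟩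
    odd (depth t' i) xor false                     ≡⟨ xor-identityʳ _ ⟩
    odd (depth t' i)                               ∎
    where
    open ≡-Reasoning
    w : ℕ → V
    w = zigzag v₀ v₁
    colour-zigzag : ∀ d → c (w d) ≡ odd d
    colour-zigzag d with odd d
    ... | true = c₁
    ... | false = c₀
    u~zigzag : ∀ d → Conn adj u (w d)
    u~zigzag d with odd d
    ... | true = u~v₁
    ... | false = u~v₀
    rule-zigzag : ∀ d e → adj (w d) (w e) ≡ c (w d) xor c (w e)
    rule-zigzag d e = rule _ _ (u~zigzag d) (u~zigzag e)
    g : _ → V
    g = w ∘ depth t
    coloured : ColouredBy c g
    coloured i j = rule-zigzag (depth t i) (depth t j)
    hom' : Hom t' g
    hom' = satisfies⇒homs⊆ t t' sat g (walk⇒hom t w (zigzag-walk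
      (trans (rule-zigzag 0 1) (cong₂ _xor_ c₀ c₁)) (trans (rule-zigzag 1 0) (cong₂ _xor_ c₁ c₀))))
    depth-root' : depth t (root t') ≡ 0
    depth-root' = trans (cong (depth t) (root-unique t' t)) (depth-root t)

  trivial-or-complete⇒satisfies : (∀ u → TrivialComp adj u ⊎ CompleteLoopsComp adj u) →
    ∀ {n} (t t' : B n) → Satisfies adj t t'
  trivial-or-complete⇒satisfies classified t t' = homs⊆⇒satisfies t t' (homs⊆ t t') (homs⊆ t' t)
    where
    homs⊆ : ∀ {n} (s s' : B n) → Homs⊆ s s'
    homs⊆ s s' g = [ trivial-homs⊆ s s' g , complete-homs⊆ s s' g ] (classified (g (root s)))

  sameParity⇒satisfies :
    (∀ u → TrivialComp adj u ⊎ CompleteLoopsComp adj u ⊎ CompleteBipartiteComp adj u) →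
    ∀ {n} (t t' : B n) → SameParity t t' → Satisfies adj t t'
  sameParity⇒satisfies classified t t' same =
    homs⊆⇒satisfies t t' (homs⊆ t t' same) (homs⊆ t' t (sym ∘ same))
    where
    homs⊆ : ∀ {n} (s s' : B n) → SameParity s s' → Homs⊆ s s'
    homs⊆ s s' same g =
      [ trivial-homs⊆ s s' g , [ complete-homs⊆ s s' g , (λ bip → bipartite-homs⊆ s s' g bip same) ] ]
        (classified (g (root s)))

-- Walks with a non-edge in a component of any other kind

module _ {ℓ} {V : Set ℓ} {adj : V → V → Bool} (adj-sym : Symmetric adj) where

  edge-sym : ∀ {a b} → Edge adj a b → Edge adj b a
  edge-sym {a} {b} = trans (adj-sym b a)

  NonEdgeWalk : ℕ → ℕ → Set ℓ
  NonEdgeWalk a b = Σ (ℕ → V) λ w → Walk adj w × adj (w a) (w b) ≡ false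

  _∷ʷ_ : V → (ℕ → V) → ℕ → V
  (v ∷ʷ w) zero = v
  (v ∷ʷ w) (suc i) = w i

  walk-∷ʷ : ∀ {v w} → Edge adj v (w 0) → Walk adj w → Walk adj (v ∷ʷ w)
  walk-∷ʷ e walk zero = e
  walk-∷ʷ e walk (suc i) = walk i

  nonEdgeWalk-suc : ∀ {a b} → NonEdgeWalk a b → NonEdgeWalk (suc a) (suc b)
  nonEdgeWalk-suc (w , walk , nonEdge) = w 1 ∷ʷ w , walk-∷ʷ (edge-sym (walk 0)) walk , nonEdge

  nonEdgeWalk-+2 : ∀ {b} → NonEdgeWalk 0 b → NonEdgeWalk 0 (2 + b)
  nonEdgeWalk-+2 (w , walk , nonEdge) =
    w 0 ∷ʷ (w 1 ∷ʷ w) , walk-∷ʷ (walk 0) (walk-∷ʷ (edge-sym (walk 0)) walk) , nonEdge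

  nonEdgeWalk-sym : ∀ {a b} → NonEdgeWalk a b → NonEdgeWalk b a
  nonEdgeWalk-sym (w , walk , nonEdge) = w , walk , trans (adj-sym _ _) nonEdge

  Closes₂ : Set ℓ
  Closes₂ = ∀ {a b c} → Edge adj a b → Edge adj b c → Edge adj a c

  Closes₃ : Set ℓ
  Closes₃ = ∀ {a b c d} → Edge adj a b → Edge adj b c → Edge adj c d → Edge adj a d

  ¬nonEdgeWalk⇒closes₂ : ¬ NonEdgeWalk 0 2 → Closes₂
  ¬nonEdgeWalk⇒closes₂ ¬nonEdgeWalk {a} {b} {c} ab bc = ¬-not λ ac≡false →
    ¬nonEdgeWalk (a ∷ʷ zigzag adj b c , walk-∷ʷ ab (zigzag-walk adj bc (edge-sym bc)) , ac≡false)

  ¬nonEdgeWalk⇒closes₃ : ¬ NonEdgeWalk 0 3 → Closes₃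
  ¬nonEdgeWalk⇒closes₃ ¬nonEdgeWalk {a} {b} {c} {d} ab bc cd = ¬-not λ ad≡false →
    ¬nonEdgeWalk (a ∷ʷ (b ∷ʷ zigzag adj c d) ,
      walk-∷ʷ ab (walk-∷ʷ bc (zigzag-walk adj cd (edge-sym cd))) , ad≡false)

  closes₂⇒closes₃ : Closes₂ → Closes₃
  closes₂⇒closes₃ closes ab bc cd = closes (closes ab bc) cd

  conn-transport : ∀ {p} (P : V → Set p) → (∀ {a b} → P a → Edge adj a b → P b) →
    ∀ {u v} → Conn adj u v → P u → P v
  conn-transport P step ε pu = pu
  conn-transport P step (e ◅ path) pu = conn-transport P step path (step pu e)

  closes₃-loop⇒complete : Closes₃ → ∀ {u} → Edge adj u u → CompleteLoopsComp adj u
  closes₃-loop⇒complete closes {u} uu v w u~v u~w = closes (edge-sym (neighbour u~v)) uu (neighbour u~w)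
    where
    neighbour : ∀ {v} → Conn adj u v → Edge adj u v
    neighbour path = conn-transport (Edge adj u) (closes uu) path uu

  -- Colour each vertex by adjacency to u: the neighbours of u against the vertices two steps away.
  closes₃-loopless⇒bipartite : Closes₃ → ∀ {u m} → Edge adj u m → adj u u ≡ false →
    CompleteBipartiteComp adj u
  closes₃-loopless⇒bipartite closes {u} {m} um loopless =
    adj u , (λ v w u~v u~w → colour (classify u~v) (classify u~w)) , (m , um ◅ ε , um) , (u , ε , loopless)
    where
    TwoSteps : V → Set ℓ
    TwoSteps v = Σ V λ m → Edge adj u m × Edge adj m v
    classify : ∀ {v} → Conn adj u v → Edge adj u v ⊎ TwoSteps v
    classify path = conn-transport _ step path (inj₂ (m , um , edge-sym um))
      where
      step : ∀ {a b} → Edge adj u a ⊎ TwoSteps a → Edge adj a b → Edge adj u b ⊎ TwoSteps b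
      step (inj₁ ua) ab = inj₂ (_ , ua , ab)
      step (inj₂ (_ , um' , m'a)) ab = inj₁ (closes um' m'a ab)
    twoSteps⇒¬edge : ∀ {v} → TwoSteps v → adj u v ≡ false
    twoSteps⇒¬edge (_ , um' , m'v) = ¬-not λ uv → not-¬ (closes um' m'v (edge-sym uv)) loopless
    colours : ∀ {v w p q} → adj u v ≡ p → adj u w ≡ q → adj v w ≡ p xor q → adj v w ≡ adj u v xor adj u w
    colours cv cw vw = trans vw (sym (cong₂ _xor_ cv cw))
    colour : ∀ {v w} → Edge adj u v ⊎ TwoSteps v → Edge adj u w ⊎ TwoSteps w → adj v w ≡ adj u v xor adj u w
    colour (inj₁ uv) (inj₁ uw) =
      colours uv uw (¬-not λ vw → not-¬ (closes uv vw (edge-sym uw)) loopless)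
    colour (inj₁ uv) (inj₂ w₂@(_ , um' , m'w)) =
      colours uv (twoSteps⇒¬edge w₂) (closes (edge-sym uv) um' m'w)
    colour (inj₂ v₂@(_ , um' , m'v)) (inj₁ uw) =
      colours (twoSteps⇒¬edge v₂) uw (trans (adj-sym _ _) (closes (edge-sym uw) um' m'v))
    colour (inj₂ v₂@(_ , um' , m'v)) (inj₂ w₂) =
      colours (twoSteps⇒¬edge v₂) (twoSteps⇒¬edge w₂) (¬-not λ vw → not-¬ (closes um' m'v vw) (twoSteps⇒¬edge w₂))

  closes₃⇒complete⊎bipartite : Closes₃ → ∀ {u m} → Edge adj u m →
    CompleteLoopsComp adj u ⊎ CompleteBipartiteComp adj u
  closes₃⇒complete⊎bipartite closes {u} um with adj u u in uu
  ... | true = inj₁ (closes₃-loop⇒complete closes uu)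
  ... | false = inj₂ (closes₃-loopless⇒bipartite closes um uu)

  Unclassified : V → Set ℓ
  Unclassified u = ¬ (TrivialComp adj u ⊎ CompleteLoopsComp adj u ⊎ CompleteBipartiteComp adj u)

  ¬trivial⇒¬¬edge : ∀ {u} → ¬ TrivialComp adj u → ¬ ¬ Σ V (Edge adj u)
  ¬trivial⇒¬¬edge {u} ¬trivial noEdge = ¬trivial ((λ _ → stays) , ¬-not (λ uu → noEdge (u , uu)))
    where
    stays : ∀ {v} → Conn adj u v → v ≡ u
    stays ε = refl
    stays (e ◅ _) = ⊥-elim (noEdge (_ , e))

  ¬¬nonEdgeWalk₂ : ∀ {u} → Unclassified u → ¬ ¬ NonEdgeWalk 0 2
  ¬¬nonEdgeWalk₂ unclassified ¬nonEdgeWalk = ¬trivial⇒¬¬edge (unclassified ∘ inj₁) λ (_ , um) →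
    unclassified (inj₂ (inj₁ (closes₃-loop⇒complete (closes₂⇒closes₃ closes) (closes um (edge-sym um)))))
    where
    closes : Closes₂
    closes = ¬nonEdgeWalk⇒closes₂ ¬nonEdgeWalk

  ¬¬nonEdgeWalk₃ : ∀ {u} → Unclassified u → ¬ ¬ NonEdgeWalk 0 3
  ¬¬nonEdgeWalk₃ unclassified ¬nonEdgeWalk = ¬trivial⇒¬¬edge (unclassified ∘ inj₁) λ (_ , um) →
    unclassified (inj₂ (closes₃⇒complete⊎bipartite (¬nonEdgeWalk⇒closes₃ ¬nonEdgeWalk) um))

  ¬¬nonEdgeWalk-from-0 : ∀ {u} → Unclassified u → ∀ L → ¬ ¬ NonEdgeWalk 0 (2 + L)
  ¬¬nonEdgeWalk-from-0 unclassified 0 = ¬¬nonEdgeWalk₂ unclassified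
  ¬¬nonEdgeWalk-from-0 unclassified 1 = ¬¬nonEdgeWalk₃ unclassified
  ¬¬nonEdgeWalk-from-0 unclassified (suc (suc L)) = ¬¬-map nonEdgeWalk-+2 (¬¬nonEdgeWalk-from-0 unclassified L)

  ¬¬nonEdgeWalk : ∀ {u} → Unclassified u → ∀ {a b} → 2 + a ≤ b → ¬ ¬ NonEdgeWalk a b
  ¬¬nonEdgeWalk unclassified {zero} {suc zero} (s≤s ())
  ¬¬nonEdgeWalk unclassified {zero} {suc (suc L)} _ = ¬¬nonEdgeWalk-from-0 unclassified L
  ¬¬nonEdgeWalk unclassified {suc a} {suc b} (s≤s 2+a≤b) = ¬¬-map nonEdgeWalk-suc (¬¬nonEdgeWalk unclassified 2+a≤b)

  farApart⇒¬¬nonEdgeWalk : ∀ {u} → Unclassified u → ∀ {a b} → FarApart a b → ¬ ¬ NonEdgeWalk a b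
  farApart⇒¬¬nonEdgeWalk unclassified =
    [ ¬¬nonEdgeWalk unclassified , ¬¬-map nonEdgeWalk-sym ∘ ¬¬nonEdgeWalk unclassified ]

  farEdge⇒¬homs⊆ : ∀ {u} → Unclassified u → ∀ {n} {t t' : B n} → FarEdge t t' → ¬ Homs⊆ adj t' t
  farEdge⇒¬homs⊆ unclassified {t' = t'} (i , j , edge , far) t'⊆t =
    farApart⇒¬¬nonEdgeWalk unclassified far λ (w , walk , nonEdge) →
      not-¬ (hom-edge adj (w ∘ depth t') edge (t'⊆t _ (walk⇒hom adj t' w walk))) nonEdge

  unclassified⇒¬satisfies : ∀ {u} → Unclassified u → ∀ {n} (t t' : B n) → t ≢ t' → ¬ Satisfies adj t t'
  unclassified⇒¬satisfies unclassified t t' t≢t' sat = ≢⇒¬¬farEdge t t' t≢t'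
    [ (λ far → farEdge⇒¬homs⊆ unclassified far (satisfies⇒homs⊆ adj t' t (sym ∘ sat)))
    , (λ far → farEdge⇒¬homs⊆ unclassified far (satisfies⇒homs⊆ adj t t' sat)) ]

proposition7p1 : ∀ {ℓ} {V : Set ℓ} (adj : V → V → Bool) → Symmetric adj →
    ((∀ (u : V) → TrivialComp adj u ⊎ CompleteLoopsComp adj u) →
      ∀ (n : ℕ) (t t' : B n) → Satisfies adj t t')
    × (((∀ (u : V) → TrivialComp adj u ⊎ CompleteLoopsComp adj u ⊎ CompleteBipartiteComp adj u)
        × (Σ V λ u → CompleteBipartiteComp adj u)) →
      ∀ (n : ℕ) (t t' : B n) → t ≢ t' → (Satisfies adj t t' ⇔ Even (M t t')))
    × ((Σ V λ u → ¬ (TrivialComp adj u ⊎ CompleteLoopsComp adj u ⊎ CompleteBipartiteComp adj u)) →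
      ∀ (n : ℕ) (t t' : B n) → t ≢ t' → ¬ Satisfies adj t t')
proposition7p1 adj adj-sym =
  (λ classified n → trivial-or-complete⇒satisfies adj classified) ,
  (λ (classified , _ , bipartite) n t t' _ → mk⇔
    (Equivalence.from (even-M⇔sameParity t t') ∘ satisfies⇒sameParity adj bipartite t t')
    (sameParity⇒satisfies adj classified t t' ∘ Equivalence.to (even-M⇔sameParity t t'))) ,
  (λ (_ , unclassified) n → unclassified⇒¬satisfies adj-sym unclassified)
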